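{- Let $G$ be a $(p,q)$-graph admitting a set-ordered graceful total coloring. Then for each $W\in\{$edge-magic, edge-difference, felicitous-difference, graceful-difference$\}$, $G$ admits a set-ordered odd-edge $W$-magic total coloring.
   Context: $[a,b]=\{a,\dots,b\}$, $[1,2q-1]^o$ is the set of odd integers in $[1,2q-1]$, $\theta(S)=\{\theta(s):s\in S\}$. A map $\theta$ on a bipartite graph is set-ordered if the two colour classes can be named $X,Y$ with $\max\theta(X)<\min\theta(Y)$. A set-ordered graceful total coloring of a $(p,q)$-graph $G$ is a map $\theta:V(G)\to[0,q]$ with $\min\theta(V(G))=0$ and $|\theta(V(G))|<p$ (some two vertices share a color), extended to edges by $\theta(xy)=|\theta(x)-\theta(y)|$, such that $\theta(E(G))=[1,q]$ and $G$ is bipartite with $\theta$ set-ordered. A set-ordered odd-edge $W$-magic total coloring of a bipartite $(p,q)$-graph $G$ is a map $f:V(G)\cup E(G)\to[0,2q-1]$ (vertex colors need not be distinct) that is set-ordered, satisfies $f(E(G))=[1,2q-1]^o$, and for some constant satisfies for every edge $uv$: edge-magic: $f(u)+f(uv)+f(v)=k_1$ ($k_1>0$); edge-difference: $f(uv)+|f(u)-f(v)|=k_2$ ($k_2>0$); felicitous-difference: $|f(u)+f(v)-f(uv)|=k_3$ ($k_3\ge0$); graceful-difference: $\big||f(u)-f(v)|-f(uv)\big|=k_4$ ($k_4\ge0$). -}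

module Defs where

open import Data.Nat using (ℕ; zero; suc; _+_; _*_; _∸_; _≤_; _<_; ∣_-_∣)
open import Data.Fin using (Fin)
open import Data.Bool using (Bool; true; false)
open import Data.Product using (Σ; ∃; ∃-syntax; _×_; _,_; proj₁; proj₂)
open import Data.Sum using (_⊎_)
open import Relation.Binary.PropositionalEquality using (_≡_; _≢_)
open import Relation.Nullary using (¬_)

record Graph (p q : ℕ) : Set where
  field
    end      : Fin q → Fin p × Fin p
    noLoop   : ∀ e → proj₁ (end e) ≢ proj₂ (end e)
    noMulti  : ∀ e e′ → ((proj₁ (end e) ≡ proj₁ (end e′) × proj₂ (end e) ≡ proj₂ (end e′))
                         ⊎ (proj₁ (end e) ≡ proj₂ (end e′) × proj₂ (end e) ≡ proj₁ (end e′)))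
                      → e ≡ e′
open Graph public

src tgt : ∀ {p q} → Graph p q → Fin q → Fin p
src G e = proj₁ (end G e)
tgt G e = proj₂ (end G e)

-- side : Fin p → Bool is a bipartition (X = false side, Y = true side) of G
IsBipartition : ∀ {p q} → Graph p q → (Fin p → Bool) → Set
IsBipartition G side = ∀ e → side (src G e) ≢ side (tgt G e)

SetOrderedWrt : ∀ {p} → (Fin p → Bool) → (Fin p → ℕ) → Set
SetOrderedWrt side θ = ∀ x y → side x ≡ false → side y ≡ true → θ x < θ y

SetOrdered : ∀ {p q} → Graph p q → (Fin p → ℕ) → Set
SetOrdered G θ = ∃[ side ] (IsBipartition G side × SetOrderedWrt side θ)

inducedEdge : ∀ {p q} → Graph p q → (Fin p → ℕ) → Fin q → ℕ
inducedEdge G θ e = ∣ θ (src G e) - θ (tgt G e) ∣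

record SetOrderedGracefulTotalColoring {p q : ℕ} (G : Graph p q) (θ : Fin p → ℕ) : Set where
  field
    range     : ∀ v → θ v ≤ q
    minZero   : ∃[ v ] θ v ≡ 0
    notInj    : ∃[ u ] ∃[ v ] (u ≢ v × θ u ≡ θ v)            -- |θ(V(G))| < p
    edgeRange : ∀ e → 1 ≤ inducedEdge G θ e × inducedEdge G θ e ≤ q
    edgeOnto  : ∀ k → 1 ≤ k → k ≤ q → ∃[ e ] inducedEdge G θ e ≡ k
    setOrd    : SetOrdered G θ

IsOdd : ℕ → Set
IsOdd n = ∃[ m ] n ≡ suc (2 * m)

data MagicType : Set where
  edgeMagic edgeDifference felicitousDifference gracefulDifference : MagicType

MagicCond : MagicType → ℕ → ℕ → ℕ → ℕ → Set
MagicCond edgeMagic            k fu fuv fv = fu + fuv + fv ≡ k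
MagicCond edgeDifference       k fu fuv fv = fuv + ∣ fu - fv ∣ ≡ k
MagicCond felicitousDifference k fu fuv fv = ∣ fu + fv - fuv ∣ ≡ k
MagicCond gracefulDifference   k fu fuv fv = ∣ ∣ fu - fv ∣ - fuv ∣ ≡ k

ConstOK : MagicType → ℕ → Set
ConstOK edgeMagic            k = 0 < k
ConstOK edgeDifference       k = 0 < k
ConstOK felicitousDifference k = 0 ≤ k
ConstOK gracefulDifference   k = 0 ≤ k

record SetOrderedOddEdgeMagicTotalColoring (W : MagicType) {p q : ℕ} (G : Graph p q)
       (fV : Fin p → ℕ) (fE : Fin q → ℕ) : Set where
  field
    vRange   : ∀ v → fV v ≤ 2 * q ∸ 1
    eRange   : ∀ e → fE e ≤ 2 * q ∸ 1
    setOrd   : SetOrdered G fV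
    eOdd     : ∀ e → IsOdd (fE e)
    eOnto    : ∀ k → IsOdd k → k ≤ 2 * q ∸ 1 → ∃[ e ] fE e ≡ k
    const    : ℕ
    constOK  : ConstOK W const
    magic    : ∀ e → MagicCond W const (fV (src G e)) (fE e) (fV (tgt G e))

{-# OPTIONS --safe #-}
-- Let X, Y be the colour classes of θ, so θ(X) ≤ M < θ(Y) for M = max θ(X).  Colour each
-- y ∈ Y by 2θ(y) − 1, each x ∈ X by 2θ(x) or by 2(M − θ(x)), and each edge of graceful
-- colour t by 2t − 1 or by 2q + 1 − 2t.  On an edge xy of colour t = θ(y) − θ(x) the vertex
-- colours satisfy |f(y) − f(x)| = 2t − 1 resp. f(x) + f(y) = 2M + 2t − 1, so the four
-- combinations are W-magic with constants 0, 2q, 2M and 2M + 2q.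

module Submission where

open import Defs
open import Data.Nat using (ℕ)
open import Data.Fin using (Fin)
open import Data.Product using (Σ; ∃; ∃-syntax; _×_)

open import Data.Bool using (Bool; true; false; if_then_else_)
open import Data.Empty using (⊥-elim)
open import Data.Fin using (zero; suc)
open import Data.Nat using (zero; suc; _+_; _*_; _∸_; _≤_; _<_; ∣_-_∣; _⊔_; z≤n; s≤s; s≤s⁻¹)
open import Data.Nat.Properties
open import Algebra.Properties.CommutativeSemigroup +-commutativeSemigroup using (xy∙z≈xz∙y; xy∙z≈zy∙x)
open import Data.Nat.Solver using (module +-*-Solver)
open import Data.Product using (_,_; proj₁; proj₂)
open import Data.Sum using (_⊎_; inj₁; inj₂)
open import Function using (_∘_)
open import Relation.Binary.PropositionalEquality using (_≡_; _≢_; refl; sym; trans; cong; subst; module ≡-Reasoning)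

open +-*-Solver using (solve; _:+_; _:*_; _:=_; con)

odd : ℕ → ℕ
odd m = suc (2 * m)

2*[1+n]∸1≡odd[n] : ∀ n → 2 * suc n ∸ 1 ≡ odd n
2*[1+n]∸1≡odd[n] n = +-suc n (n + 0)

m<n⇒odd[m]≤2n∸1 : ∀ {m n} → m < n → odd m ≤ 2 * n ∸ 1
m<n⇒odd[m]≤2n∸1 {m} {suc n} (s≤s m≤n) =
  subst (odd m ≤_) (sym (2*[1+n]∸1≡odd[n] n)) (s≤s (*-monoʳ-≤ 2 m≤n))

m<n⇒2m≤2n∸1 : ∀ {m n} → m < n → 2 * m ≤ 2 * n ∸ 1
m<n⇒2m≤2n∸1 {m} m<n = ≤-trans (n≤1+n (2 * m)) (m<n⇒odd[m]≤2n∸1 m<n)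

odd[m]≤2n∸1⇒m<n : ∀ {m n} → odd m ≤ 2 * n ∸ 1 → m < n
odd[m]≤2n∸1⇒m<n {m} {suc n} le =
  s≤s (*-cancelˡ-≤ 2 (s≤s⁻¹ (subst (odd m ≤_) (2*[1+n]∸1≡odd[n] n) le)))

odd[m+n]≡2m+odd[n] : ∀ m n → odd (m + n) ≡ 2 * m + odd n
odd[m+n]≡2m+odd[n] = solve 2 (λ m n → con 1 :+ con 2 :* (m :+ n) := con 2 :* m :+ (con 1 :+ con 2 :* n)) refl

∣2m-odd[m+n]∣≡odd[n] : ∀ m n → ∣ 2 * m - odd (m + n) ∣ ≡ odd n
∣2m-odd[m+n]∣≡odd[n] m n = trans (cong (∣ 2 * m -_∣) (odd[m+n]≡2m+odd[n] m n)) (∣m-m+n∣≡n (2 * m) (odd n))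

2[m∸a]+odd[a+n]≡2m+odd[n] : ∀ {a m} n → a ≤ m → 2 * (m ∸ a) + odd (a + n) ≡ 2 * m + odd n
2[m∸a]+odd[a+n]≡2m+odd[n] {a} n a≤m with m≤n⇒∃[o]m+o≡n a≤m
... | r , refl = trans (cong (λ k → 2 * k + odd (a + n)) (m+n∸m≡n a r))
  (solve 3 (λ a r n → con 2 :* r :+ (con 1 :+ con 2 :* (a :+ n)) := con 2 :* (a :+ r) :+ (con 1 :+ con 2 :* n)) refl a r n)

odd[d]+odd[q∸1+d]≡2q : ∀ {d q} → d < q → odd d + odd (q ∸ suc d) ≡ 2 * q
odd[d]+odd[q∸1+d]≡2q {d} d<q with m≤n⇒∃[o]m+o≡n d<q
... | s , refl = trans (cong (λ k → odd d + odd k) (m+n∸m≡n d s))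
  (solve 2 (λ d s → con 1 :+ con 2 :* d :+ (con 1 :+ con 2 :* s) := con 2 :* (con 1 :+ (d :+ s))) refl d s)

∣m-1+m+n∣≡1+n : ∀ m n → ∣ m - suc (m + n) ∣ ≡ suc n
∣m-1+m+n∣≡1+n m n = trans (cong (∣ m -_∣) (sym (+-suc m n))) (∣m-m+n∣≡n m (suc n))

∣m+n-n∣≡m : ∀ m n → ∣ m + n - n ∣ ≡ m
∣m+n-n∣≡m m n = trans (m≤n⇒∣n-m∣≡n∸m (m≤n+m n m)) (m+n∸n≡m m n)

MagicCond-sym : ∀ W {k a c b} → MagicCond W k a c b → MagicCond W k b c a
MagicCond-sym edgeMagic {a = a} {c} {b} eq = trans (xy∙z≈zy∙x b c a) eq
MagicCond-sym edgeDifference {a = a} {c} {b} eq = trans (cong (c +_) (∣-∣-comm b a)) eq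
MagicCond-sym felicitousDifference {a = a} {c} {b} eq = trans (cong (∣_- c ∣) (+-comm b a)) eq
MagicCond-sym gracefulDifference {a = a} {c} {b} eq = trans (cong (∣_- c ∣) (∣-∣-comm b a)) eq

maximum : ∀ {n} → (Fin n → ℕ) → ℕ
maximum {zero}  g = 0
maximum {suc n} g = g zero ⊔ maximum (g ∘ suc)

≤-maximum : ∀ {n} (g : Fin n → ℕ) i → g i ≤ maximum g
≤-maximum g zero    = m≤m⊔n _ _
≤-maximum g (suc i) = ≤-trans (≤-maximum (g ∘ suc) i) (m≤n⊔m _ _)

maximum-lub : ∀ {n} {g : Fin n → ℕ} {b} → (∀ i → g i ≤ b) → maximum g ≤ b
maximum-lub {zero}  g≤b = z≤n
maximum-lub {suc n} g≤b = ⊔-lub (g≤b zero) (maximum-lub (g≤b ∘ suc))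

separatingThreshold : ∀ {p} {side : Fin p → Bool} {θ : Fin p → ℕ} → SetOrderedWrt side θ →
  ∃[ M ] (∀ x → side x ≡ false → θ x ≤ M) × (∀ y → side y ≡ true → M ≤ θ y ∸ 1)
separatingThreshold {p} {side} {θ} ordered = maximum θX , θX≤M , M≤θY∸1
  where
  θX : Fin p → ℕ
  θX v = if side v then 0 else θ v

  θX≤M : ∀ x → side x ≡ false → θ x ≤ maximum θX
  θX≤M x sx = subst (_≤ maximum θX) (cong (if_then 0 else θ x) sx) (≤-maximum θX x)

  M≤θY∸1 : ∀ y → side y ≡ true → maximum θX ≤ θ y ∸ 1
  M≤θY∸1 y sy = maximum-lub θX≤θy∸1
    where
    θX≤θy∸1 : ∀ v → θX v ≤ θ y ∸ 1
    θX≤θy∸1 v with side v in sv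
    ... | true  = z≤n
    ... | false = <⇒≤pred (ordered v y sv sy)

crossingEdge : ∀ {b c : Bool} → b ≢ c → (b ≡ false × c ≡ true) ⊎ (b ≡ true × c ≡ false)
crossingEdge {false} {false} b≢c = ⊥-elim (b≢c refl)
crossingEdge {false} {true}  _   = inj₁ (refl , refl)
crossingEdge {true}  {false} _   = inj₂ (refl , refl)
crossingEdge {true}  {true}  b≢c = ⊥-elim (b≢c refl)

module Recolouring (M q : ℕ) where

  vertexIndex : MagicType → ℕ → ℕ
  vertexIndex edgeMagic            a = M ∸ a
  vertexIndex edgeDifference       a = a
  vertexIndex felicitousDifference a = M ∸ a
  vertexIndex gracefulDifference   a = a

  edgeIndex : MagicType → ℕ → ℕ
  edgeIndex edgeMagic            t = q ∸ t
  edgeIndex edgeDifference       t = q ∸ t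
  edgeIndex felicitousDifference t = t ∸ 1
  edgeIndex gracefulDifference   t = t ∸ 1

  magicConstant : MagicType → ℕ
  magicConstant edgeMagic            = 2 * M + 2 * q
  magicConstant edgeDifference       = 2 * q
  magicConstant felicitousDifference = 2 * M
  magicConstant gracefulDifference   = 0

  vertexIndex-≤ : ∀ W {a} → a ≤ M → vertexIndex W a ≤ M
  vertexIndex-≤ edgeMagic            {a} _   = m∸n≤m M a
  vertexIndex-≤ edgeDifference       a≤M = a≤M
  vertexIndex-≤ felicitousDifference {a} _   = m∸n≤m M a
  vertexIndex-≤ gracefulDifference   a≤M = a≤M

  edgeIndex-< : ∀ W {t} → 1 ≤ t → t ≤ q → edgeIndex W t < q
  edgeIndex-< edgeMagic            1≤t t≤q = ∸-monoʳ-< 1≤t t≤q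
  edgeIndex-< edgeDifference       1≤t t≤q = ∸-monoʳ-< 1≤t t≤q
  edgeIndex-< felicitousDifference (s≤s z≤n) t≤q = t≤q
  edgeIndex-< gracefulDifference   (s≤s z≤n) t≤q = t≤q

  edgeIndex-onto : ∀ W {m} → m < q → ∃[ t ] (1 ≤ t × t ≤ q × edgeIndex W t ≡ m)
  edgeIndex-onto edgeMagic            {m} m<q = q ∸ m , m<n⇒0<n∸m m<q , m∸n≤m q m , m∸[m∸n]≡n (<⇒≤ m<q)
  edgeIndex-onto edgeDifference       {m} m<q = q ∸ m , m<n⇒0<n∸m m<q , m∸n≤m q m , m∸[m∸n]≡n (<⇒≤ m<q)
  edgeIndex-onto felicitousDifference {m} m<q = suc m , s≤s z≤n , m<q , refl
  edgeIndex-onto gracefulDifference   {m} m<q = suc m , s≤s z≤n , m<q , refl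

  magicConstant-OK : ∀ W → 0 < q → ConstOK W (magicConstant W)
  magicConstant-OK edgeMagic            0<q = ≤-trans (≤-trans 0<q (m≤m+n q _)) (m≤n+m (2 * q) (2 * M))
  magicConstant-OK edgeDifference       0<q = ≤-trans 0<q (m≤m+n q _)
  magicConstant-OK felicitousDifference _   = z≤n
  magicConstant-OK gracefulDifference   _   = z≤n

  -- An edge from x ∈ X to y ∈ Y with θ(x) = a and θ(y) = 1 + a + d, so of colour 1 + d.
  magicCond-gap : ∀ W {a d} → a ≤ M → d < q →
    MagicCond W (magicConstant W) (2 * vertexIndex W a) (odd (edgeIndex W (suc d))) (odd (a + d))
  magicCond-gap edgeMagic {a} {d} a≤M d<q = begin
    2 * (M ∸ a) + odd (q ∸ suc d) + odd (a + d) ≡⟨ xy∙z≈xz∙y (2 * (M ∸ a)) _ _ ⟩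
    2 * (M ∸ a) + odd (a + d) + odd (q ∸ suc d) ≡⟨ cong (_+ odd (q ∸ suc d)) (2[m∸a]+odd[a+n]≡2m+odd[n] d a≤M) ⟩
    2 * M + odd d + odd (q ∸ suc d)             ≡⟨ +-assoc (2 * M) _ _ ⟩
    2 * M + (odd d + odd (q ∸ suc d))           ≡⟨ cong (2 * M +_) (odd[d]+odd[q∸1+d]≡2q d<q) ⟩
    2 * M + 2 * q                               ∎
    where open ≡-Reasoning
  magicCond-gap edgeDifference {a} {d} _ d<q = begin
    odd (q ∸ suc d) + ∣ 2 * a - odd (a + d) ∣ ≡⟨ cong (odd (q ∸ suc d) +_) (∣2m-odd[m+n]∣≡odd[n] a d) ⟩
    odd (q ∸ suc d) + odd d                 ≡⟨ +-comm (odd (q ∸ suc d)) (odd d) ⟩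
    odd d + odd (q ∸ suc d)                 ≡⟨ odd[d]+odd[q∸1+d]≡2q d<q ⟩
    2 * q                                   ∎
    where open ≡-Reasoning
  magicCond-gap felicitousDifference {a} {d} a≤M _ =
    trans (cong (∣_- odd d ∣) (2[m∸a]+odd[a+n]≡2m+odd[n] d a≤M)) (∣m+n-n∣≡m (2 * M) (odd d))
  magicCond-gap gracefulDifference {a} {d} _ _ =
    trans (cong (∣_- odd d ∣) (∣2m-odd[m+n]∣≡odd[n] a d)) (∣n-n∣≡0 (odd d))

  magicCond-ordered : ∀ W {a b} → a ≤ M → a < b → b ≤ q →
    MagicCond W (magicConstant W) (2 * vertexIndex W a) (odd (edgeIndex W ∣ a - b ∣)) (odd (b ∸ 1))
  magicCond-ordered W {a} a≤M a<b b≤q with m≤n⇒∃[o]m+o≡n a<b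
  ... | d , refl rewrite ∣m-1+m+n∣≡1+n a d = magicCond-gap W a≤M (≤-trans (s≤s (m≤n+m d a)) b≤q)

module _ {p n} (G : Graph p (suc n)) {θ : Fin p → ℕ} (C : SetOrderedGracefulTotalColoring G θ)
         (W : MagicType) where

  open SetOrderedGracefulTotalColoring C

  side : Fin p → Bool
  side = proj₁ setOrd

  bipartite : IsBipartition G side
  bipartite = proj₁ (proj₂ setOrd)

  ordered : SetOrderedWrt side θ
  ordered = proj₂ (proj₂ setOrd)

  M : ℕ
  M = proj₁ (separatingThreshold ordered)

  θX≤M : ∀ x → side x ≡ false → θ x ≤ M
  θX≤M = proj₁ (proj₂ (separatingThreshold ordered))

  M≤θY∸1 : ∀ y → side y ≡ true → M ≤ θ y ∸ 1
  M≤θY∸1 = proj₂ (proj₂ (separatingThreshold ordered))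

  M<q : M < suc n
  M<q with crossingEdge (bipartite zero)
  ... | inj₁ (_ , sy) = s≤s (≤-trans (M≤θY∸1 _ sy) (∸-monoˡ-≤ 1 (range _)))
  ... | inj₂ (sy , _) = s≤s (≤-trans (M≤θY∸1 _ sy) (∸-monoˡ-≤ 1 (range _)))

  open Recolouring M (suc n)

  vertexColour : Fin p → ℕ
  vertexColour v = if side v then odd (θ v ∸ 1) else 2 * vertexIndex W (θ v)

  edgeColour : Fin (suc n) → ℕ
  edgeColour e = odd (edgeIndex W (inducedEdge G θ e))

  magic-XY : ∀ {x y} → side x ≡ false → side y ≡ true →
    MagicCond W (magicConstant W) (vertexColour x) (odd (edgeIndex W ∣ θ x - θ y ∣)) (vertexColour y)
  magic-XY {x} {y} sx sy rewrite sx | sy = magicCond-ordered W (θX≤M x sx) (ordered x y sx sy) (range y)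

  magic : ∀ e → MagicCond W (magicConstant W) (vertexColour (src G e)) (edgeColour e) (vertexColour (tgt G e))
  magic e with crossingEdge (bipartite e)
  ... | inj₁ (sx , sy) = magic-XY sx sy
  ... | inj₂ (sy , sx) = MagicCond-sym W
    (subst (λ t → MagicCond W (magicConstant W) (vertexColour (tgt G e)) (odd (edgeIndex W t)) (vertexColour (src G e)))
           (∣-∣-comm (θ (tgt G e)) (θ (src G e)))
           (magic-XY sx sy))

  vertexColour-≤ : ∀ v → vertexColour v ≤ 2 * suc n ∸ 1
  vertexColour-≤ v with side v in sv
  ... | true  = m<n⇒odd[m]≤2n∸1 (s≤s (∸-monoˡ-≤ 1 (range v)))
  ... | false = m<n⇒2m≤2n∸1 (≤-<-trans (vertexIndex-≤ W (θX≤M v sv)) M<q)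

  vertexColour-setOrdered : SetOrderedWrt side vertexColour
  vertexColour-setOrdered x y sx sy rewrite sx | sy =
    s≤s (*-monoʳ-≤ 2 (≤-trans (vertexIndex-≤ W (θX≤M x sx)) (M≤θY∸1 y sy)))

  edgeColour-onto : ∀ k → IsOdd k → k ≤ 2 * suc n ∸ 1 → ∃[ e ] edgeColour e ≡ k
  edgeColour-onto _ (m , refl) k≤ with edgeIndex-onto W {m} (odd[m]≤2n∸1⇒m<n {m} k≤)
  ... | t , 1≤t , t≤q , index≡m with edgeOnto t 1≤t t≤q
  ... | e , colour≡t = e , cong odd (trans (cong (edgeIndex W) colour≡t) index≡m)

  oddEdgeMagicColouring : ∃[ fV ] ∃[ fE ] SetOrderedOddEdgeMagicTotalColoring W G fV fE
  oddEdgeMagicColouring = vertexColour , edgeColour , record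
    { vRange  = vertexColour-≤
    ; eRange  = λ e → m<n⇒odd[m]≤2n∸1 (edgeIndex-< W (proj₁ (edgeRange e)) (proj₂ (edgeRange e)))
    ; setOrd  = side , bipartite , vertexColour-setOrdered
    ; eOdd    = λ e → edgeIndex W (inducedEdge G θ e) , refl
    ; eOnto   = edgeColour-onto
    ; const   = magicConstant W
    ; constOK = magicConstant-OK W (s≤s z≤n)
    ; magic   = magic
    }

ConstOK-1 : ∀ W → ConstOK W 1
ConstOK-1 edgeMagic            = s≤s z≤n
ConstOK-1 edgeDifference       = s≤s z≤n
ConstOK-1 felicitousDifference = z≤n
ConstOK-1 gracefulDifference   = z≤n

edgeless-oddEdgeMagicColouring : ∀ {p} (G : Graph p 0) W →
  ∃[ fV ] ∃[ fE ] SetOrderedOddEdgeMagicTotalColoring W G fV fE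
edgeless-oddEdgeMagicColouring G W = (λ _ → 0) , (λ ()) , record
  { vRange  = λ _ → z≤n
  ; eRange  = λ ()
  ; setOrd  = (λ _ → false) , (λ ()) , (λ { _ _ _ () })
  ; eOdd    = λ ()
  ; eOnto   = λ { _ (_ , refl) () }
  ; const   = 1
  ; constOK = ConstOK-1 W
  ; magic   = λ ()
  }

mainTheorem13 : ∀ {p q} (G : Graph p q) →
    (∃[ θ ] SetOrderedGracefulTotalColoring G θ) →
    (W : MagicType) →
    ∃[ fV ] ∃[ fE ] SetOrderedOddEdgeMagicTotalColoring W G fV fE
mainTheorem13 {q = zero}  G _       W = edgeless-oddEdgeMagicColouring G W
mainTheorem13 {q = suc n} G (_ , C) W = oddEdgeMagicColouring G C W
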